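{- A finite group $\Gamma$ has a good pair if and only if $\Gamma$ has order at least $4$.
   Context: A pair $\{x,y\}\subseteq\Gamma$ is a good pair if $x$ and $y$ are distinct, neither is the identity of $\Gamma$, $x^2\neq y$, and $y^2\neq x$. -}

module Defs where

open import Level using (Level; _⊔_)
open import Algebra.Bundles using (Group)
open import Data.Nat using (ℕ)
open import Data.Fin using (Fin)
open import Data.Product using (Σ; _×_)
open import Function.Bundles using (Inverse)
open import Relation.Binary.PropositionalEquality using (setoid)
open import Relation.Nullary using (¬_)

HasOrder : ∀ {c ℓ} → Group c ℓ → ℕ → Set (c ⊔ ℓ)
HasOrder G n = Inverse (Group.setoid G) (setoid (Fin n))

IsGoodPair : ∀ {c ℓ} (G : Group c ℓ) → Group.Carrier G → Group.Carrier G → Set ℓ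
IsGoodPair G x y =
  ¬ (x ≈ y) × ¬ (x ≈ ε) × ¬ (y ≈ ε) × ¬ ((x ∙ x) ≈ y) × ¬ ((y ∙ y) ≈ x)
  where open Group G

HasGoodPair : ∀ {c ℓ} → Group c ℓ → Set (c ⊔ ℓ)
HasGoodPair G = Σ (Group.Carrier G) λ x → Σ (Group.Carrier G) λ y → IsGoodPair G x y

-- Four distinct elements are forced by a good pair {x, y}: ε, x, y and x y⁻¹ are
-- pairwise distinct, the last because x y⁻¹ ≈ y would give y² ≈ x. Conversely, in
-- a group with at least four elements take x ≠ ε and then y ∉ {ε, x, x²}. The pair
-- {x, y} is good unless y² ≈ x; in that case y² ≉ ε and y³ ≉ ε (else y ≈ y⁴ ≈ x²),
-- and such a y forms a good pair with y⁻¹.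
module Submission where

open import Defs
open import Algebra.Bundles using (Group)
open import Data.Nat using (ℕ; _≥_)
open import Function.Bundles using (_⇔_)

open import Data.Nat using (_≤_; _<_; s≤s; z≤n)
open import Data.Nat.Properties using (≤-trans; <⇒≱)
open import Data.Fin using (Fin)
open import Data.Fin.Patterns using (0F; 1F; 2F)
open import Data.Fin.Properties using (_≟_; any?; ¬∀⟶∃¬; injective⇒≤)
open import Data.Product using (∃; _,_; proj₁; proj₂)
open import Data.Vec using (Vec; []; _∷_; lookup)
open import Data.Vec.Relation.Unary.All using ([]; _∷_)
import Data.Vec.Relation.Unary.Unique.Setoid as UniqueSetoid
import Data.Vec.Relation.Unary.Unique.Setoid.Properties as UniqueSetoidₚ
open import Function.Bundles using (Inverse; Injection; mk⇔)
open import Function.Properties.Inverse using (Inverse⇒Injection)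
open import Relation.Binary.Bundles using (Setoid)
open import Relation.Binary.Definitions using (Decidable)
open import Relation.Binary.PropositionalEquality as ≡ using (_≡_)
open import Relation.Nullary using (¬_; Dec; yes; no)
open import Relation.Nullary.Decidable using (map′)
import Algebra.Properties.Group as GroupProperties
import Relation.Binary.Reasoning.Setoid as SetoidReasoning
import Relation.Binary.Properties.Setoid as SetoidProperties

module _ {a ℓ} {S : Setoid a ℓ} {n : ℕ} (I : Inverse S (≡.setoid (Fin n))) where
  open Setoid S renaming (Carrier to A)
  open Inverse I using (to; from; to-cong; strictlyInverseˡ)
  open Injection (Inverse⇒Injection I) using (injective)
  open UniqueSetoid S using (Unique)

  ≈-dec : Decidable _≈_
  ≈-dec x y = map′ injective to-cong (to x ≟ to y)

  unique⇒length≤ : ∀ {k} {xs : Vec A k} → Unique xs → k ≤ n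
  unique⇒length≤ u =
    injective⇒≤ (λ {i} {j} e → UniqueSetoidₚ.lookup-injective S u i j (injective e))

  -- If every j : Fin n were hit by some entry of xs, choosing such an entry would be
  -- an injection Fin n → Fin k, impossible when k < n.
  ∃-fresh : ∀ {k} (xs : Vec A k) → k < n → ∃ λ d → ∀ i → ¬ (d ≈ lookup xs i)
  ∃-fresh xs k<n with ¬∀⟶∃¬ n Hit (λ j → any? (λ i → to (lookup xs i) ≟ j)) ¬surjective
    where
    Hit : Fin n → Set
    Hit j = ∃ λ i → to (lookup xs i) ≡ j

    ¬surjective : ¬ (∀ j → Hit j)
    ¬surjective hit = <⇒≱ k<n (injective⇒≤ {f = λ j → proj₁ (hit j)} choice-injective)
      where
      choice-injective : ∀ {j j′} → proj₁ (hit j) ≡ proj₁ (hit j′) → j ≡ j′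
      choice-injective {j} {j′} e = ≡.trans (≡.sym (proj₂ (hit j)))
        (≡.trans (≡.cong (λ i → to (lookup xs i)) e) (proj₂ (hit j′)))
  ... | j , ¬hit = from j , λ i d≈xᵢ →
    ¬hit (i , ≡.sym (≡.trans (≡.sym (strictlyInverseˡ j)) (to-cong d≈xᵢ)))

module _ {c ℓ} (G : Group c ℓ) where
  open Group G
  open GroupProperties G using (∙-cancelˡ; x∙y⁻¹≈ε⇒x≈y; ⁻¹-injective; ε⁻¹≈ε)
  open SetoidReasoning setoid
  open SetoidProperties setoid using (≉-sym)
  open UniqueSetoid setoid using (Unique; []; _∷_)

  x⁻¹≈ε⇒x≈ε : ∀ {x} → x ⁻¹ ≈ ε → x ≈ ε
  x⁻¹≈ε⇒x≈ε e = ⁻¹-injective (trans e (sym ε⁻¹≈ε))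

  ∙-inverseʳ-cancel : ∀ x y → (x ∙ y ⁻¹) ∙ y ≈ x
  ∙-inverseʳ-cancel x y = begin
    (x ∙ y ⁻¹) ∙ y ≈⟨ assoc x (y ⁻¹) y ⟩
    x ∙ (y ⁻¹ ∙ y) ≈⟨ ∙-congˡ (inverseˡ y) ⟩
    x ∙ ε          ≈⟨ identityʳ x ⟩
    x              ∎

  goodPair-unique : ∀ {x y} → IsGoodPair G x y → Unique (ε ∷ x ∷ y ∷ x ∙ y ⁻¹ ∷ [])
  goodPair-unique {x} {y} (x≉y , x≉ε , y≉ε , _ , y²≉x) =
    (≉-sym x≉ε ∷ ≉-sym y≉ε ∷ (λ e → x≉y (x∙y⁻¹≈ε⇒x≈y x y (sym e))) ∷ []) ∷
    (x≉y ∷ x≉xy⁻¹ ∷ []) ∷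
    ((λ e → y²≉x (trans (∙-congʳ e) (∙-inverseʳ-cancel x y))) ∷ []) ∷
    [] ∷ []
    where
    x≉xy⁻¹ : ¬ (x ≈ x ∙ y ⁻¹)
    x≉xy⁻¹ e = y≉ε (x⁻¹≈ε⇒x≈ε (sym (∙-cancelˡ x ε (y ⁻¹) (trans (identityʳ x) e))))

  isGoodPair-⁻¹ : ∀ g → ¬ (g ∙ g ≈ ε) → ¬ ((g ∙ g) ∙ g ≈ ε) → IsGoodPair G g (g ⁻¹)
  isGoodPair-⁻¹ g g²≉ε g³≉ε =
    (λ e → g²≉ε (trans (∙-congˡ e) (inverseʳ g))) ,
    (λ e → g²≉ε (square-ε e)) ,
    (λ e → g²≉ε (square-ε (x⁻¹≈ε⇒x≈ε e))) ,
    (λ e → g³≉ε (trans (∙-congʳ e) (inverseˡ g))) ,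
    (λ e → g³≉ε (trans (∙-congˡ (sym e)) cube-cancel))
    where
    square-ε : ∀ {u} → u ≈ ε → u ∙ u ≈ ε
    square-ε u≈ε = trans (∙-cong u≈ε u≈ε) (identityˡ ε)

    cube-cancel : (g ∙ g) ∙ (g ⁻¹ ∙ g ⁻¹) ≈ ε
    cube-cancel = begin
      (g ∙ g) ∙ (g ⁻¹ ∙ g ⁻¹) ≈⟨ sym (assoc (g ∙ g) (g ⁻¹) (g ⁻¹)) ⟩
      ((g ∙ g) ∙ g ⁻¹) ∙ g ⁻¹ ≈⟨ ∙-congʳ (trans (assoc g g (g ⁻¹)) (∙-congˡ (inverseʳ g))) ⟩
      (g ∙ ε) ∙ g ⁻¹          ≈⟨ ∙-congʳ (identityʳ g) ⟩
      g ∙ g ⁻¹                ≈⟨ inverseʳ g ⟩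
      ε                       ∎

  goodPair-avoiding : ∀ {x y} → ¬ (x ≈ ε) → ¬ (y ≈ ε) → ¬ (y ≈ x) → ¬ (y ≈ x ∙ x) →
                      Dec (y ∙ y ≈ x) → HasGoodPair G
  goodPair-avoiding {x} {y} x≉ε y≉ε y≉x y≉x² (no y²≉x) =
    x , y , ≉-sym y≉x , x≉ε , y≉ε , ≉-sym y≉x² , y²≉x
  goodPair-avoiding {x} {y} x≉ε y≉ε y≉x y≉x² (yes y²≈x) =
    y , y ⁻¹ , isGoodPair-⁻¹ y (λ e → x≉ε (trans (sym y²≈x) e)) (λ e → y≉x² (y≈x² e))
    where
    y≈x² : (y ∙ y) ∙ y ≈ ε → y ≈ x ∙ x
    y≈x² y³≈ε = begin
      y                 ≈⟨ sym (identityˡ y) ⟩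
      ε ∙ y             ≈⟨ ∙-congʳ (sym y³≈ε) ⟩
      ((y ∙ y) ∙ y) ∙ y ≈⟨ assoc (y ∙ y) y y ⟩
      (y ∙ y) ∙ (y ∙ y) ≈⟨ ∙-cong y²≈x y²≈x ⟩
      x ∙ x             ∎

lemma4p4 : ∀ {c ℓ} (G : Group c ℓ) (n : ℕ) → HasOrder G n →
    (HasGoodPair G ⇔ n ≥ 4)
lemma4p4 G n I = mk⇔ forth back
  where
  open Group G
  forth : HasGoodPair G → n ≥ 4
  forth (x , y , good) = unique⇒length≤ I (goodPair-unique G good)

  back : n ≥ 4 → HasGoodPair G
  back 4≤n with ∃-fresh I (ε ∷ []) (≤-trans (s≤s (s≤s z≤n)) 4≤n)
  ... | x , x≉ with ∃-fresh I (ε ∷ x ∷ x ∙ x ∷ []) 4≤n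
  ... | y , y≉ = goodPair-avoiding G (x≉ 0F) (y≉ 0F) (y≉ 1F) (y≉ 2F) (≈-dec I (y ∙ y) x)
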